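{- Let $\lambda,k,n\geq1$ be integers with $n\geq 3\lambda 2^k$, and let $G$ be the directed graph with source $s$ constructed as in the context. Then every $(\lambda,k)$-FT-BFP of $G$ (with source $s$) contains $\Omega(2^k\lambda n)$ edges.
   Context: Construction of $G$: take $\lambda$ vertex-disjoint complete binary trees $B_1,\dots,B_\lambda$ of height $k$ (edges directed from parent to child), and a new vertex $s$ with an edge from $s$ to the root of each $B_i$. Let $X$ be the set of all leaves of these trees, and let $Y$ be a set of $n-\sum_{i=1}^{\lambda}|V(B_i)|-1$ further vertices (so $|Y|\geq n/3$). Add an edge from every $x\in X$ to every $y\in Y$. Thus $V(G)=\{s\}\cup V(B_1)\cup\dots\cup V(B_\lambda)\cup Y$. Edges have unit capacity; $\textsc{max-flow}(s,t,G)$ is the maximum number of edge-disjoint $s$-to-$t$ paths and $G\setminus F$ is $G$ with the edges of $F$ deleted. A $(\lambda,k)$-FT-BFP of $G$ is a subgraph $H=(V,E_H)$, $E_H\subseteq E(G)$, such that for every $F\subseteq E(G)$ with $|F|\leq k$ and every vertex $t$: if $\textsc{max-flow}(s,t,G\setminus F)\leq\lambda$ then $\textsc{max-flow}(s,t,H\setminus F)=\textsc{max-flow}(s,t,G\setminus F)$, and otherwise $\textsc{max-flow}(s,t,H\setminus F)\geq\lambda$. -}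

module Defs where

open import Data.Nat using (ℕ; zero; suc; _+_; _*_; _∸_; _^_; _≤_; _<_)
open import Data.Bool using (Bool; true; false; if_then_else_)
open import Data.Product using (_×_; _,_; ∃-syntax; Σ-syntax)
open import Data.List using (List; []; _∷_; length; concatMap; map; upTo)
open import Data.Nat.ListAction using (sum)
open import Data.List.Membership.Propositional using (_∈_)
open import Data.List.Relation.Unary.Unique.Propositional using (Unique)
open import Data.List.Relation.Unary.All using (All)
open import Relation.Nullary using (¬_)
open import Relation.Binary.PropositionalEquality using (_≡_)

-- Generic directed graphs on vertex set ℕ, given by an edge predicate.
-- Graphs are simple, so an edge is identified with the pair (u , v).

EdgeRel : Set₁
EdgeRel = ℕ → ℕ → Set

data Walk (E : EdgeRel) : ℕ → ℕ → Set where
  []  : ∀ {u} → Walk E u u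
  _∷_ : ∀ {u v w} → E u v → Walk E v w → Walk E u w

walkEdges : ∀ {E u w} → Walk E u w → List (ℕ × ℕ)
walkEdges [] = []
walkEdges (_∷_ {u} {v} _ p) = (u , v) ∷ walkEdges p

HasDisjointPaths : EdgeRel → ℕ → ℕ → ℕ → Set
HasDisjointPaths E s t m =
  Σ[ ps ∈ List (Walk E s t) ] (length ps ≡ m × Unique (concatMap walkEdges ps))

MaxFlow : EdgeRel → ℕ → ℕ → ℕ → Set
MaxFlow E s t m =
  HasDisjointPaths E s t m × (∀ m' → HasDisjointPaths E s t m' → m' ≤ m)

_∖_ : EdgeRel → List (ℕ × ℕ) → EdgeRel
(E ∖ F) u v = E u v × ¬ ((u , v) ∈ F)

-- Vertex encoding (vertices are 0 … n-1):
--   0                      : the source s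
--   1 + i * N + j          : node j (heap order: root 0, children of j are
--                            2j+1 and 2j+2) of tree B_i, i < λ, j < N,
--                            where N = 2^(k+1) - 1 = |V(B_i)|
--                            (complete binary tree of height k);
--                            leaves are the nodes j with 2^k ≤ j + 1
--   1 + λ * N ≤ y < n      : the vertices of Y.

treeSize : ℕ → ℕ
treeSize k = 2 ^ suc k ∸ 1

data GEdge (l k n : ℕ) : ℕ → ℕ → Set where
  s→root : ∀ i → i < l → GEdge l k n 0 (1 + i * treeSize k)
  left   : ∀ i j → i < l → j + 1 < 2 ^ k →
           GEdge l k n (1 + i * treeSize k + j) (1 + i * treeSize k + (2 * j + 1))
  right  : ∀ i j → i < l → j + 1 < 2 ^ k →
           GEdge l k n (1 + i * treeSize k + j) (1 + i * treeSize k + (2 * j + 2))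
  leaf→Y : ∀ i j y → i < l → 2 ^ k ≤ j + 1 → j < treeSize k →
           1 + l * treeSize k ≤ y → y < n →
           GEdge l k n (1 + i * treeSize k + j) y

SubgraphOf : EdgeRel → (ℕ → ℕ → Bool) → Set
SubgraphOf E H = ∀ u v → H u v ≡ true → E u v

asRel : (ℕ → ℕ → Bool) → EdgeRel
asRel H u v = H u v ≡ true

edgeCount : ℕ → (ℕ → ℕ → Bool) → ℕ
edgeCount n H = sum (map (λ u → sum (map (λ v → if H u v then 1 else 0) (upTo n))) (upTo n))

IsFTBFP : (l k n : ℕ) → EdgeRel → ℕ → (ℕ → ℕ → Bool) → Set
IsFTBFP l k n E s H =
  SubgraphOf E H ×
  (∀ (F : List (ℕ × ℕ)) → length F ≤ k → All (λ e → E (Data.Product.proj₁ e) (Data.Product.proj₂ e)) F →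
   ∀ t → t < n → ∀ m → MaxFlow (E ∖ F) s t m →
     (m ≤ l → MaxFlow (asRel H ∖ F) s t m) ×
     (l < m → ∃[ m' ] (MaxFlow (asRel H ∖ F) s t m' × l ≤ m')))

{-# OPTIONS --safe #-}
module Submission where

-- Fix a tree B_i, a leaf x of B_i reached from the root along the bit string BS, and a
-- vertex y ∈ Y. Let F be the k edges leaving the root-to-x path ("exits"). In G ∖ F the
-- λ trees still carry λ edge-disjoint s–y paths (each descends its tree along BS), and s
-- has out-degree λ, so max-flow(s, y, G ∖ F) = λ. Hence H ∖ F also has λ edge-disjoint
-- s–y paths; one of them enters B_i, and in B_i ∖ F the only way down from the root is the
-- path BS, which ends in x, so H contains the edge x → y. Thus H contains all λ 2^k |Y|
-- edges from leaves to Y, and |Y| ≥ n/3.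

open import Defs
open import Data.Nat using (ℕ; zero; suc; _+_; _*_; _∸_; _^_; _≤_; _<_; z≤n; s≤s; s≤s⁻¹; z<s; s<s)
open import Data.Nat.Properties
open import Data.Nat.ListAction using (sum)
open import Data.Nat.Tactic.RingSolver using (solve-∀)
open import Data.Bool using (Bool; true; false; not; if_then_else_)
open import Data.List using (List; []; _∷_; _++_; _∷ʳ_; length; map; concatMap; upTo; applyUpTo)
open import Data.List.Properties
  using (length-++; length-map; length-removeAt′; length-upTo; map-∘; map-upTo)
open import Data.List.Membership.Propositional using (_∈_; _∉_; _─_)
open import Data.List.Membership.Propositional.Properties
  using (∈-++⁺ˡ; ∈-++⁺ʳ; ∈-upTo⁺; ∈-map⁺; ∈-map⁻)
open import Data.List.Membership.DecPropositional Data.Nat._≟_ using (_∈?_)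
open import Data.List.Relation.Unary.Any using (here; there; index)
open import Data.List.Relation.Unary.All as All using (All; []; _∷_)
import Data.List.Relation.Unary.All.Properties as Allₚ
open import Data.List.Relation.Unary.AllPairs using ([]; _∷_)
open import Data.List.Relation.Unary.Unique.Propositional using (Unique)
import Data.List.Relation.Unary.Unique.Propositional.Properties as Uniqueₚ
open import Data.List.Relation.Binary.Subset.Propositional using (_⊆_)
open import Data.Product using (_×_; _,_; ∃-syntax; proj₁; proj₂; map₁)
open import Data.Sum using (_⊎_; inj₁; inj₂)
open import Function using (_∘_; id)
open import Relation.Nullary using (¬_; yes; no; contradiction)
open import Relation.Binary.PropositionalEquality

-- Unique lists

module _ {A : Set} where

  ∈-─ : ∀ {x z : A} {ys} (x∈ys : x ∈ ys) → z ∈ ys → x ≢ z → z ∈ ys ─ x∈ys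
  ∈-─ (here refl)  (here refl)  x≢z = contradiction refl x≢z
  ∈-─ (here refl)  (there z∈ys) x≢z = z∈ys
  ∈-─ (there x∈ys) (here refl)  x≢z = here refl
  ∈-─ (there x∈ys) (there z∈ys) x≢z = there (∈-─ x∈ys z∈ys x≢z)

  Unique-⊆⇒length-≤ : ∀ {xs ys : List A} → Unique xs → xs ⊆ ys → length xs ≤ length ys
  Unique-⊆⇒length-≤ {[]}          _            _     = z≤n
  Unique-⊆⇒length-≤ {x ∷ xs} {ys} (x∉xs ∷ !xs) xs⊆ys = begin
    suc (length xs)          ≤⟨ s≤s (Unique-⊆⇒length-≤ !xs xs⊆ys─x) ⟩
    suc (length (ys ─ x∈ys)) ≡⟨ length-removeAt′ ys (index x∈ys) ⟨
    length ys                ∎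
    where
    open ≤-Reasoning
    x∈ys : x ∈ ys
    x∈ys = xs⊆ys (here refl)
    xs⊆ys─x : xs ⊆ ys ─ x∈ys
    xs⊆ys─x z∈xs = ∈-─ x∈ys (xs⊆ys (there z∈xs)) (All.lookup x∉xs z∈xs)

  Unique-++⁻ʳ : ∀ xs {ys : List A} → Unique (xs ++ ys) → Unique ys
  Unique-++⁻ʳ []       !ys           = !ys
  Unique-++⁻ʳ (_ ∷ xs) (_ ∷ !xs++ys) = Unique-++⁻ʳ xs !xs++ys

  Unique-++⇒disjoint : ∀ xs {ys : List A} {z} → Unique (xs ++ ys) → z ∈ xs → z ∉ ys
  Unique-++⇒disjoint (x ∷ xs) (x∉xs++ys ∷ _) (here refl)  z∈ys =
    All.lookup x∉xs++ys (∈-++⁺ʳ xs z∈ys) refl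
  Unique-++⇒disjoint (x ∷ xs) (_ ∷ !xs++ys)  (there z∈xs) z∈ys =
    Unique-++⇒disjoint xs !xs++ys z∈xs z∈ys

module _ {A B : Set} {f : A → B} {g : A → List B} (f∈g : ∀ x → f x ∈ g x) where

  ∈-concatMap : ∀ {x xs} → x ∈ xs → f x ∈ concatMap g xs
  ∈-concatMap             (here refl)  = ∈-++⁺ˡ (f∈g _)
  ∈-concatMap {xs = x ∷ _} (there x∈xs) = ∈-++⁺ʳ (g x) (∈-concatMap x∈xs)

  Unique-concatMap⇒Unique-map : ∀ xs → Unique (concatMap g xs) → Unique (map f xs)
  Unique-concatMap⇒Unique-map []       _   = []
  Unique-concatMap⇒Unique-map (x ∷ xs) !gs =
    All.tabulate fx≢ ∷ Unique-concatMap⇒Unique-map xs (Unique-++⁻ʳ (g x) !gs)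
    where
    fx≢ : ∀ {z} → z ∈ map f xs → f x ≢ z
    fx≢ z∈fxs fx≡z with x′ , x′∈xs , refl ← ∈-map⁻ f z∈fxs =
      Unique-++⇒disjoint (g x) !gs (f∈g x)
        (subst (_∈ concatMap g xs) (sym fx≡z) (∈-concatMap x′∈xs))

Unique-<⇒length-≤ : ∀ {xs} b → Unique xs → All (_< b) xs → length xs ≤ b
Unique-<⇒length-≤ {xs} b !xs xs<b = begin
  length xs       ≤⟨ Unique-⊆⇒length-≤ !xs (∈-upTo⁺ ∘ All.lookup xs<b) ⟩
  length (upTo b) ≡⟨ length-upTo b ⟩
  b               ∎
  where open ≤-Reasoning

Unique-<-full⇒∈ : ∀ {xs} b → Unique xs → All (_< b) xs → length xs ≡ b → ∀ {i} → i < b → i ∈ xs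
Unique-<-full⇒∈ {xs} b !xs xs<b refl {i} i<b with i ∈? xs
... | yes i∈xs = i∈xs
... | no  i∉xs = contradiction
  (Unique-<⇒length-≤ b (Allₚ.¬Any⇒All¬ xs i∉xs ∷ !xs) (i<b ∷ xs<b)) (<-irrefl refl)

-- Sums over ranges

sum-applyUpTo-+ : ∀ f a b →
  sum (applyUpTo f (a + b)) ≡ sum (applyUpTo f a) + sum (applyUpTo (f ∘ (a +_)) b)
sum-applyUpTo-+ f zero    b = refl
sum-applyUpTo-+ f (suc a) b = begin
  f 0 + sum (applyUpTo (f ∘ suc) (a + b))
    ≡⟨ cong (f 0 +_) (sum-applyUpTo-+ (f ∘ suc) a b) ⟩
  f 0 + (sum (applyUpTo (f ∘ suc) a) + sum (applyUpTo (f ∘ (suc a +_)) b))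
    ≡⟨ +-assoc (f 0) _ _ ⟨
  f 0 + sum (applyUpTo (f ∘ suc) a) + sum (applyUpTo (f ∘ (suc a +_)) b)
    ∎
  where open ≡-Reasoning

sum-applyUpTo-mono : ∀ f {m n} → m ≤ n → sum (applyUpTo f m) ≤ sum (applyUpTo f n)
sum-applyUpTo-mono f {m} {n} m≤n = begin
  sum (applyUpTo f m)                                        ≤⟨ m≤m+n _ _ ⟩
  sum (applyUpTo f m) + sum (applyUpTo (f ∘ (m +_)) (n ∸ m)) ≡⟨ sum-applyUpTo-+ f m (n ∸ m) ⟨
  sum (applyUpTo f (m + (n ∸ m)))                            ≡⟨ cong (sum ∘ applyUpTo f) (m+[n∸m]≡n m≤n) ⟩
  sum (applyUpTo f n)                                        ∎
  where open ≤-Reasoning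

sum-applyUpTo-≥ : ∀ f n {c} → (∀ {u} → u < n → c ≤ f u) → n * c ≤ sum (applyUpTo f n)
sum-applyUpTo-≥ f zero    c≤f = z≤n
sum-applyUpTo-≥ f (suc n) c≤f = +-mono-≤ (c≤f z<s) (sum-applyUpTo-≥ (f ∘ suc) n (c≤f ∘ s<s))

sum-applyUpTo-≥-interval : ∀ f {a b c m} → a + b ≤ m → (∀ {u} → u < b → c ≤ f (a + u)) →
                           b * c ≤ sum (applyUpTo f m)
sum-applyUpTo-≥-interval f {a} {b} {c} {m} a+b≤m c≤f = begin
  b * c                                                ≤⟨ sum-applyUpTo-≥ (f ∘ (a +_)) b c≤f ⟩
  sum (applyUpTo (f ∘ (a +_)) b)                       ≤⟨ m≤n+m _ _ ⟩
  sum (applyUpTo f a) + sum (applyUpTo (f ∘ (a +_)) b) ≡⟨ sum-applyUpTo-+ f a b ⟨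
  sum (applyUpTo f (a + b))                            ≤⟨ sum-applyUpTo-mono f a+b≤m ⟩
  sum (applyUpTo f m)                                  ∎
  where open ≤-Reasoning

sum-applyUpTo-≥-blocks : ∀ f {N a b c} m → a + b ≤ N →
                         (∀ {i u} → i < m → u < b → c ≤ f (i * N + (a + u))) →
                         m * (b * c) ≤ sum (applyUpTo f (m * N))
sum-applyUpTo-≥-blocks f                     zero    _     _   = z≤n
sum-applyUpTo-≥-blocks f {N} {a} {b} {c} (suc m) a+b≤N c≤f = begin
  b * c + m * (b * c)
    ≤⟨ +-mono-≤ (sum-applyUpTo-≥-interval f a+b≤N (c≤f z<s))
                (sum-applyUpTo-≥-blocks (f ∘ (N +_)) m a+b≤N c≤f′) ⟩
  sum (applyUpTo f N) + sum (applyUpTo (f ∘ (N +_)) (m * N))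
    ≡⟨ sum-applyUpTo-+ f N (m * N) ⟨
  sum (applyUpTo f (N + m * N))
    ∎
  where
  open ≤-Reasoning
  c≤f′ : ∀ {i u} → i < m → u < b → c ≤ f (N + (i * N + (a + u)))
  c≤f′ {i} {u} i<m u<b = subst (λ v → c ≤ f v) (+-assoc N (i * N) (a + u)) (c≤f (s<s i<m) u<b)

-- Complete binary trees in heap order

child : Bool → ℕ → ℕ
child false j = 2 * j + 1
child true  j = 2 * j + 2

descend : ℕ → List Bool → ℕ
descend j []       = j
descend j (b ∷ bs) = descend (child b j) bs

descend-∷ʳ : ∀ j bs b → descend j (bs ∷ʳ b) ≡ child b (descend j bs)
descend-∷ʳ j []        b = refl
descend-∷ʳ j (b′ ∷ bs) b = descend-∷ʳ (child b′ j) bs b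

suc-child-false : ∀ j → suc (2 * j + 1) ≡ 2 * suc j
suc-child-false = solve-∀

suc-child-true : ∀ j → suc (2 * j + 2) ≡ suc (2 * suc j)
suc-child-true = solve-∀

j<child : ∀ b j → j < child b j
j<child false j = ≤-<-trans (m≤n*m j 2) (m<m+n (2 * j) z<s)
j<child true  j = ≤-<-trans (m≤n*m j 2) (m<m+n (2 * j) z<s)

child-false<child-true : ∀ j → child false j < child true j
child-false<child-true j = +-monoʳ-< (2 * j) (s<s z<s)

child-onto : ∀ j → ∃[ p ] ∃[ b ] child b p ≡ suc j
child-onto zero    = 0 , false , refl
child-onto (suc j) = parent-of-next (child-onto j)
  where
  right≡1+left : ∀ p → 2 * p + 2 ≡ suc (2 * p + 1)
  right≡1+left = solve-∀
  left-of-next≡1+right : ∀ p → 2 * suc p + 1 ≡ suc (2 * p + 2)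
  left-of-next≡1+right = solve-∀
  parent-of-next : ∃[ p ] ∃[ b ] child b p ≡ suc j → ∃[ p ] ∃[ b ] child b p ≡ suc (suc j)
  parent-of-next (p , false , eq) = p     , true  , trans (right≡1+left p) (cong suc eq)
  parent-of-next (p , true  , eq) = suc p , false , trans (left-of-next≡1+right p) (cong suc eq)

data OnPath : ℕ → List Bool → ℕ → Set where
  start : ∀ {j bs} → OnPath j bs j
  next  : ∀ {j b bs c} → OnPath (child b j) bs c → OnPath j (b ∷ bs) c

OnPath⇒≤ : ∀ {j bs c} → OnPath j bs c → j ≤ c
OnPath⇒≤ start            = ≤-refl
OnPath⇒≤ (next {b = b} o) = ≤-trans (<⇒≤ (j<child b _)) (OnPath⇒≤ o)

OnPath-∷⁻ : ∀ {j b bs c} → OnPath j (b ∷ bs) c → c ≡ j ⊎ OnPath (child b j) bs c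
OnPath-∷⁻ start    = inj₁ refl
OnPath-∷⁻ (next o) = inj₂ o

¬OnPath-∷ : ∀ {j b bs c} → j < c → ¬ OnPath (child b j) bs c → ¬ OnPath j (b ∷ bs) c
¬OnPath-∷ j<c c∉ o with OnPath-∷⁻ o
... | inj₁ refl = <-irrefl refl j<c
... | inj₂ o′   = c∉ o′

OnPath⇒≡⊎≥ : ∀ {j bs c} → OnPath j bs c → c ≡ j ⊎ child false j ≤ c
OnPath⇒≡⊎≥ start            = inj₁ refl
OnPath⇒≡⊎≥ (next {b = b} o) = inj₂ (≤-trans (child-false≤child b _) (OnPath⇒≤ o))
  where
  child-false≤child : ∀ b j → child false j ≤ child b j
  child-false≤child false j = ≤-refl
  child-false≤child true  j = <⇒≤ (child-false<child-true j)

sibling∉path : ∀ b j {bs} → ¬ OnPath (child b j) bs (child (not b) j)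
sibling∉path true  j o = <⇒≱ (child-false<child-true j) (OnPath⇒≤ o)
sibling∉path false j o with OnPath⇒≡⊎≥ o
... | inj₁ eq = >⇒≢ (child-false<child-true j) eq
... | inj₂ le = <⇒≱ (subst (suc (2 * j + 2) ≤_) (grandchild j) (m≤m+n _ (2 * j))) le
  where
  grandchild : ∀ j → suc (2 * j + 2) + 2 * j ≡ 2 * (2 * j + 1) + 1
  grandchild = solve-∀

record Depth (d j : ℕ) : Set where
  constructor depth
  field
    lower : 2 ^ d ≤ suc j
    upper : suc j < 2 ^ suc d

depth-root : Depth 0 0
depth-root = depth ≤-refl ≤-refl

Depth0⇒root : ∀ {j} → Depth 0 j → j ≡ 0
Depth0⇒root {zero}  _                           = refl
Depth0⇒root {suc j} (depth _ (s≤s (s≤s ())))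

¬Depth-suc-root : ∀ {d} → ¬ Depth (suc d) 0
¬Depth-suc-root {d} (depth lower _) with ≤-trans (*-monoʳ-≤ 2 (m^n>0 2 d)) lower
... | s≤s ()

depth-child : ∀ {d j} → Depth d j → ∀ b → Depth (suc d) (child b j)
depth-child {d} {j} (depth lower upper) false = depth
  (begin
    2 * 2 ^ d        ≤⟨ *-monoʳ-≤ 2 lower ⟩
    2 * suc j        ≡⟨ suc-child-false j ⟨
    suc (2 * j + 1)  ∎)
  (begin-strict
    suc (2 * j + 1)  ≡⟨ suc-child-false j ⟩
    2 * suc j        <⟨ *-monoʳ-< 2 upper ⟩
    2 * 2 ^ suc d    ∎)
  where open ≤-Reasoning
depth-child {d} {j} (depth lower upper) true = depth
  (begin
    2 * 2 ^ d              ≤⟨ *-monoʳ-≤ 2 lower ⟩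
    2 * suc j              ≤⟨ n≤1+n _ ⟩
    suc (2 * suc j)        ≡⟨ suc-child-true j ⟨
    suc (2 * j + 2)        ∎)
  (begin
    suc (suc (2 * j + 2))  ≡⟨ cong suc (suc-child-true j) ⟩
    2 + 2 * suc j          ≡⟨ *-suc 2 (suc j) ⟨
    2 * suc (suc j)        ≤⟨ *-monoʳ-≤ 2 upper ⟩
    2 * 2 ^ suc d          ∎)
  where open ≤-Reasoning

depth-parent : ∀ {d p} b → Depth (suc d) (child b p) → Depth d p
depth-parent {d} {p} false (depth lower upper) = depth
  (*-cancelˡ-≤ 2 (begin
    2 * 2 ^ d        ≤⟨ lower ⟩
    suc (2 * p + 1)  ≡⟨ suc-child-false p ⟩
    2 * suc p        ∎))
  (*-cancelˡ-< 2 _ _ (begin-strict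
    2 * suc p        ≡⟨ suc-child-false p ⟨
    suc (2 * p + 1)  <⟨ upper ⟩
    2 * 2 ^ suc d    ∎))
  where open ≤-Reasoning
depth-parent {d} {p} true (depth lower upper) = depth
  (s≤s⁻¹ (*-cancelˡ-< 2 _ _ (begin-strict
    2 * 2 ^ d              ≤⟨ lower ⟩
    suc (2 * p + 2)        ≡⟨ suc-child-true p ⟩
    suc (2 * suc p)        <⟨ n<1+n _ ⟩
    2 + 2 * suc p          ≡⟨ *-suc 2 (suc p) ⟨
    2 * suc (suc p)        ∎)))
  (*-cancelˡ-≤ 2 (begin
    2 * suc (suc p)        ≡⟨ *-suc 2 (suc p) ⟩
    2 + 2 * suc p          ≡⟨ cong suc (suc-child-true p) ⟨
    suc (suc (2 * p + 2))  ≤⟨ upper ⟩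
    2 * 2 ^ suc d          ∎))
  where open ≤-Reasoning

descend-onto : ∀ d {j} → Depth d j → ∃[ bs ] (length bs ≡ d × descend 0 bs ≡ j)
descend-onto zero            dj = [] , refl , sym (Depth0⇒root dj)
descend-onto (suc d) {zero}  dj = contradiction dj ¬Depth-suc-root
descend-onto (suc d) {suc j} dj
  with p , b , child≡ ← child-onto j
  with bs , length≡ , descend≡ ← descend-onto d (depth-parent b (subst (Depth (suc d)) (sym child≡) dj))
  = bs ∷ʳ b , length-∷ʳ , descend-∷ʳ≡
  where
  length-∷ʳ : length (bs ∷ʳ b) ≡ suc d
  length-∷ʳ = trans (length-++ bs) (trans (+-comm (length bs) 1) (cong suc length≡))
  descend-∷ʳ≡ : descend 0 (bs ∷ʳ b) ≡ suc j
  descend-∷ʳ≡ = begin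
    descend 0 (bs ∷ʳ b)     ≡⟨ descend-∷ʳ 0 bs b ⟩
    child b (descend 0 bs)  ≡⟨ cong (child b) descend≡ ⟩
    child b p               ≡⟨ child≡ ⟩
    suc j                   ∎
    where open ≡-Reasoning

suc-treeSize : ∀ k → suc (treeSize k) ≡ 2 ^ suc k
suc-treeSize k = trans (+-comm 1 (treeSize k)) (m∸n+n≡m (m^n>0 2 (suc k)))

treeSize-split : ∀ k → treeSize k ≡ (2 ^ k ∸ 1) + 2 ^ k
treeSize-split k = begin
  2 ^ k + (2 ^ k + 0) ∸ 1  ≡⟨ cong (λ m → 2 ^ k + m ∸ 1) (+-identityʳ (2 ^ k)) ⟩
  2 ^ k + 2 ^ k ∸ 1        ≡⟨ +-∸-comm (2 ^ k) (m^n>0 2 k) ⟩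
  (2 ^ k ∸ 1) + 2 ^ k      ∎
  where open ≡-Reasoning

internal-< : ∀ {k j} → j + 1 < 2 ^ k → j < treeSize k
internal-< {k} {j} internal = ∸-monoˡ-≤ 1 (begin-strict
  suc j      ≡⟨ +-comm 1 j ⟩
  j + 1      <⟨ internal ⟩
  2 ^ k      ≤⟨ ^-monoʳ-≤ 2 (n≤1+n k) ⟩
  2 ^ suc k  ∎)
  where open ≤-Reasoning

leaf⇒Depth : ∀ {k j} → 2 ^ k ≤ j + 1 → j < treeSize k → Depth k j
leaf⇒Depth {k} {j} leaf j<N = depth
  (subst (2 ^ k ≤_) (+-comm j 1) leaf)
  (subst (_≤ 2 ^ suc k) (+-comm (suc j) 1) (m≤o∸n⇒m+n≤o (suc j) (m^n>0 2 (suc k)) j<N))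

record LeafPath (k j : ℕ) (bs : List Bool) : Set where
  constructor leafPath
  field
    {d}      : ℕ
    atDepth  : Depth d j
    toLeaves : d + length bs ≡ k

LeafPath-root : ∀ {k bs} → length bs ≡ k → LeafPath k 0 bs
LeafPath-root = leafPath depth-root

LeafPath-child : ∀ {k j b bs} → LeafPath k j (b ∷ bs) → ∀ b′ → LeafPath k (child b′ j) bs
LeafPath-child {bs = bs} (leafPath {d} dj eq) b′ =
  leafPath (depth-child dj b′) (trans (sym (+-suc d (length bs))) eq)

LeafPath-internal : ∀ {k j b bs} → LeafPath k j (b ∷ bs) → j + 1 < 2 ^ k
LeafPath-internal {k} {j} {bs = bs} (leafPath {d} dj eq) = begin-strict
  j + 1       ≡⟨ +-comm j 1 ⟩
  suc j       <⟨ Depth.upper dj ⟩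
  2 ^ suc d   ≤⟨ ^-monoʳ-≤ 2 (subst (suc d ≤_) suc-d+|bs|≡k (m≤m+n (suc d) (length bs))) ⟩
  2 ^ k       ∎
  where
  open ≤-Reasoning
  suc-d+|bs|≡k : suc d + length bs ≡ k
  suc-d+|bs|≡k = trans (sym (+-suc d (length bs))) eq

LeafPath-leaf : ∀ {k j} → LeafPath k j [] → 2 ^ k ≤ j + 1
LeafPath-leaf {k} {j} (leafPath {d} dj eq) = begin
  2 ^ k   ≡⟨ cong (2 ^_) (trans (sym (+-identityʳ d)) eq) ⟨
  2 ^ d   ≤⟨ Depth.lower dj ⟩
  suc j   ≡⟨ +-comm 1 j ⟩
  j + 1   ∎
  where open ≤-Reasoning

LeafPath-< : ∀ {k j bs} → LeafPath k j bs → j < treeSize k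
LeafPath-< {k} {j} {bs} (leafPath {d} dj eq) =
  ∸-monoˡ-≤ 1 (≤-trans (Depth.upper dj) (^-monoʳ-≤ 2 (s≤s (subst (d ≤_) eq (m≤m+n d (length bs))))))

descend-LeafPath : ∀ {k j} bs → LeafPath k j bs → LeafPath k (descend j bs) []
descend-LeafPath []       lp = lp
descend-LeafPath (b ∷ bs) lp = descend-LeafPath bs (LeafPath-child lp b)

onPath-< : ∀ {k j bs c} → LeafPath k j bs → OnPath j bs c → c < treeSize k
onPath-< lp start            = LeafPath-< lp
onPath-< lp (next {b = b} o) = onPath-< (LeafPath-child lp b) o

onPath-leaf : ∀ {k j bs c} → LeafPath k j bs → OnPath j bs c → 2 ^ k ≤ c + 1 → c ≡ descend j bs
onPath-leaf {bs = []}    lp start            leaf = refl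
onPath-leaf {bs = _ ∷ _} lp start            leaf = contradiction leaf (<⇒≱ (LeafPath-internal lp))
onPath-leaf              lp (next {b = b} o) leaf = onPath-leaf (LeafPath-child lp b) o leaf

data TreeEdge (k : ℕ) : ℕ → ℕ → Set where
  toChild : ∀ {j} b → j + 1 < 2 ^ k → TreeEdge k j (child b j)

-- Deleting the exits of a path leaves it as the only way down from its start (onPath-child).
exits : ℕ → List Bool → List (ℕ × ℕ)
exits j []       = []
exits j (b ∷ bs) = (j , child (not b) j) ∷ exits (child b j) bs

exits-length : ∀ j bs → length (exits j bs) ≡ length bs
exits-length j []       = refl
exits-length j (b ∷ bs) = cong suc (exits-length (child b j) bs)

exits-TreeEdge : ∀ {k j} bs → LeafPath k j bs → All (λ e → TreeEdge k (proj₁ e) (proj₂ e)) (exits j bs)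
exits-TreeEdge []       lp = []
exits-TreeEdge (b ∷ bs) lp =
  toChild (not b) (LeafPath-internal lp) ∷ exits-TreeEdge bs (LeafPath-child lp b)

exits-offPath : ∀ {k j bs a c} → LeafPath k j bs → (a , c) ∈ exits j bs →
                j < c × c < treeSize k × ¬ OnPath j bs c
exits-offPath {j = j} {b ∷ bs} lp (here refl) =
  j<child (not b) j , LeafPath-< (LeafPath-child lp (not b)) ,
  ¬OnPath-∷ (j<child (not b) j) (sibling∉path b j)
exits-offPath {j = j} {b ∷ bs} {c = c} lp (there e∈) with exits-offPath (LeafPath-child lp b) e∈
... | child<c , c<N , c∉ = j<c , c<N , ¬OnPath-∷ j<c c∉
  where
  j<c : j < c
  j<c = <-trans (j<child b j) child<c

onPath-child : ∀ {k j bs a} → LeafPath k j bs → OnPath j bs a → a + 1 < 2 ^ k →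
               ∀ b → (a , child b a) ∉ exits j bs → OnPath j bs (child b a)
onPath-child {bs = []}         lp start internal b     _      = contradiction (LeafPath-leaf lp) (<⇒≱ internal)
onPath-child {bs = false ∷ bs} lp start internal false _      = next start
onPath-child {bs = true  ∷ bs} lp start internal true  _      = next start
onPath-child {bs = false ∷ bs} lp start internal true  ∉exits = contradiction (here refl) ∉exits
onPath-child {bs = true  ∷ bs} lp start internal false ∉exits = contradiction (here refl) ∉exits
onPath-child lp (next {b = b′} o) internal b ∉exits =
  next (onPath-child (LeafPath-child lp b′) o internal b (∉exits ∘ there))

-- Walks whose edge ranks increase

_++ʷ_ : ∀ {E u v w} → Walk E u v → Walk E v w → Walk E u w
[]      ++ʷ q = q
(e ∷ p) ++ʷ q = e ∷ (p ++ʷ q)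

-- Edges out of the source 0 are ranked by their target and all others by their source, so
-- that along a walk in a graph whose edges go from smaller to larger vertices the ranks
-- strictly increase.
rank : ℕ × ℕ → ℕ
rank (zero  , v) = 2 * v
rank (suc u , _) = suc (2 * suc u)

data Ascending : ℕ → ℕ → List (ℕ × ℕ) → Set where
  []  : ∀ {lo hi} → lo ≤ hi → Ascending lo hi []
  _∷_ : ∀ {lo hi e es} → lo ≤ rank e → Ascending (suc (rank e)) hi es → Ascending lo hi (e ∷ es)

Ascending-weaken : ∀ {lo′ lo hi es} → lo′ ≤ lo → Ascending lo hi es → Ascending lo′ hi es
Ascending-weaken lo′≤lo ([] lo≤hi)   = [] (≤-trans lo′≤lo lo≤hi)
Ascending-weaken lo′≤lo (lo≤e ∷ asc) = ≤-trans lo′≤lo lo≤e ∷ asc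

Ascending-++ : ∀ {lo mid hi xs ys} → Ascending lo mid xs → Ascending mid hi ys → Ascending lo hi (xs ++ ys)
Ascending-++ ([] lo≤mid)   asc₂ = Ascending-weaken lo≤mid asc₂
Ascending-++ (lo≤e ∷ asc₁) asc₂ = lo≤e ∷ Ascending-++ asc₁ asc₂

Ascending-lower : ∀ {lo hi es} → Ascending lo hi es → All (λ e → lo ≤ rank e) es
Ascending-lower ([] _)       = []
Ascending-lower (lo≤e ∷ asc) = lo≤e ∷ All.map (≤-trans (≤-trans lo≤e (n≤1+n _))) (Ascending-lower asc)

Ascending⇒Unique : ∀ {lo hi es} → Ascending lo hi es → Unique es
Ascending⇒Unique ([] _)    = []
Ascending⇒Unique (_ ∷ asc) =
  All.map (λ e<e′ e≡e′ → <-irrefl (cong rank e≡e′) e<e′) (Ascending-lower asc) ∷ Ascending⇒Unique asc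

Ascending-++ʷ : ∀ {E} → (∀ {u v} → E u v → u < v) →
                ∀ {u v w hi} (p : Walk E (suc u) v) (q : Walk E v w) →
                Ascending (suc (2 * v)) hi (walkEdges q) →
                Ascending (suc (2 * suc u)) hi (walkEdges (p ++ʷ q))
Ascending-++ʷ up []                    q asc = asc
Ascending-++ʷ up (_∷_ {v = zero}  e p) q asc = contradiction (up e) λ ()
Ascending-++ʷ up (_∷_ {v = suc _} e p) q asc =
  ≤-refl ∷ Ascending-weaken (s≤s (*-monoʳ-< 2 (up e))) (Ascending-++ʷ up p q asc)

-- The graph G

*+-injective : ∀ N {i i′ a a′} → a < N → a′ < N → i * N + a ≡ i′ * N + a′ → i ≡ i′ × a ≡ a′
*+-injective N {zero}  {zero}              a<N a′<N eq = refl , eq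
*+-injective N {zero}  {suc i′} {a′ = a′}  a<N a′<N eq =
  contradiction (subst (N ≤_) (sym eq) (≤-trans (m≤m+n N _) (m≤m+n _ a′))) (<⇒≱ a<N)
*+-injective N {suc i} {zero}   {a}        a<N a′<N eq =
  contradiction (subst (N ≤_) eq (≤-trans (m≤m+n N _) (m≤m+n _ a))) (<⇒≱ a′<N)
*+-injective N {suc i} {suc i′} {a} {a′}   a<N a′<N eq =
  map₁ (cong suc) (*+-injective N a<N a′<N (+-cancelˡ-≡ N _ _ (begin
    N + (i * N + a)    ≡⟨ +-assoc N (i * N) a ⟨
    N + i * N + a      ≡⟨ eq ⟩
    N + i′ * N + a′    ≡⟨ +-assoc N (i′ * N) a′ ⟩
    N + (i′ * N + a′)  ∎)))
  where open ≡-Reasoning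

n≤3[n∸a] : ∀ {a} A {n} → a ≤ 2 * A → 3 * A ≤ n → n ≤ 3 * (n ∸ a)
n≤3[n∸a] {a} A {n} a≤2A 3A≤n = begin
  n            ≡⟨ m+[n∸m]≡n 2A≤n ⟨
  2 * A + r    ≤⟨ +-monoˡ-≤ r (*-monoʳ-≤ 2 A≤r) ⟩
  2 * r + r    ≡⟨ +-comm (2 * r) r ⟩
  3 * r        ≤⟨ *-monoʳ-≤ 3 (∸-monoʳ-≤ n a≤2A) ⟩
  3 * (n ∸ a)  ∎
  where
  open ≤-Reasoning
  r : ℕ
  r = n ∸ 2 * A
  3A≡2A+A : ∀ A → 3 * A ≡ 2 * A + A
  3A≡2A+A = solve-∀
  2A+A≤n : 2 * A + A ≤ n
  2A+A≤n = subst (_≤ n) (3A≡2A+A A) 3A≤n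
  2A≤n : 2 * A ≤ n
  2A≤n = ≤-trans (m≤m+n (2 * A) A) 2A+A≤n
  A≤r : A ≤ r
  A≤r = subst (_≤ r) (m+n∸m≡n (2 * A) A) (∸-monoˡ-≤ (2 * A) 2A+A≤n)

module Construction (l k n : ℕ) where

  N : ℕ
  N = treeSize k

  vertex : ℕ → ℕ → ℕ
  vertex i j = 1 + i * N + j

  Y₀ : ℕ
  Y₀ = 1 + l * N

  G : EdgeRel
  G = GEdge l k n

  vertex-injective : ∀ {i i′ a a′} → a < N → a′ < N → vertex i a ≡ vertex i′ a′ → i ≡ i′ × a ≡ a′
  vertex-injective a<N a′<N eq = *+-injective N a<N a′<N (suc-injective eq)

  vertex-<-next : ∀ {i a} → a < N → vertex i a < vertex (suc i) 0
  vertex-<-next {i} {a} a<N = s≤s (begin-strict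
    i * N + a      <⟨ +-monoʳ-< (i * N) a<N ⟩
    i * N + N      ≡⟨ +-comm (i * N) N ⟩
    N + i * N      ≡⟨ +-identityʳ (N + i * N) ⟨
    N + i * N + 0  ∎)
    where open ≤-Reasoning

  vertex-< : ∀ {i a} → i < l → a < N → vertex i a < Y₀
  vertex-< {i} {a} i<l a<N = begin-strict
    vertex i a         <⟨ vertex-<-next {i} a<N ⟩
    1 + suc i * N + 0  ≡⟨ cong suc (+-identityʳ (suc i * N)) ⟩
    1 + suc i * N      ≤⟨ s≤s (*-monoˡ-≤ N i<l) ⟩
    Y₀                 ∎
    where open ≤-Reasoning

  treeEdge : ∀ {i a c} → i < l → TreeEdge k a c → G (vertex i a) (vertex i c)
  treeEdge i<l (toChild false internal) = left  _ _ i<l internal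
  treeEdge i<l (toChild true  internal) = right _ _ i<l internal

  G-source-< : ∀ {u v} → G u v → u < Y₀
  G-source-< (s→root _ _)                 = z<s
  G-source-< (left  i _ i<l internal)     = vertex-< {i} i<l (internal-< {k} internal)
  G-source-< (right i _ i<l internal)     = vertex-< {i} i<l (internal-< {k} internal)
  G-source-< (leaf→Y i _ _ i<l _ j<N _ _) = vertex-< {i} i<l j<N

  G-upward : ∀ {u v} → G u v → u < v
  G-upward (s→root _ _)                   = z<s
  G-upward (left  i j _ _)                = +-monoʳ-< (1 + i * N) (j<child false j)
  G-upward (right i j _ _)                = +-monoʳ-< (1 + i * N) (j<child true j)
  G-upward (leaf→Y i _ _ i<l _ j<N Y₀≤y _) = <-≤-trans (vertex-< {i} i<l j<N) Y₀≤y

  Y-sink : ∀ {E} → (∀ {u v} → E u v → G u v) → ∀ {v t} → Walk E v t → Y₀ ≤ v → v ≡ t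
  Y-sink E⊆G []      _    = refl
  Y-sink E⊆G (e ∷ _) Y₀≤v = contradiction (G-source-< (E⊆G e)) (≤⇒≯ Y₀≤v)

  module Departures {E : EdgeRel} (E⊆G : ∀ {u v} → E u v → G u v) {t : ℕ} (t≢s : t ≢ 0) where

    departure : (w : Walk E 0 t) → ∃[ i ] (i < l × (0 , 1 + i * N) ∈ walkEdges w × Walk E (1 + i * N) t)
    departure []      = contradiction refl t≢s
    departure (e ∷ w) with E⊆G e
    ... | s→root i i<l = i , i<l , here refl , w

    tree : Walk E 0 t → ℕ
    tree w = proj₁ (departure w)

    trees-Unique : ∀ ps → Unique (concatMap walkEdges ps) → Unique (map tree ps)
    trees-Unique ps !ps = Uniqueₚ.map⁻ {f = λ i → 0 , 1 + i * N} (subst Unique (map-∘ ps)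
      (Unique-concatMap⇒Unique-map (proj₁ ∘ proj₂ ∘ proj₂ ∘ departure) ps !ps))

    trees-< : ∀ ps → All (_< l) (map tree ps)
    trees-< ps = Allₚ.map⁺ (All.tabulate (λ {w} _ → proj₁ (proj₂ (departure w))))

    disjointPaths-≤ : ∀ {m} → HasDisjointPaths E 0 t m → m ≤ l
    disjointPaths-≤ (ps , refl , !ps) =
      subst (_≤ l) (length-map tree ps) (Unique-<⇒length-≤ l (trees-Unique ps !ps) (trees-< ps))

    disjointPaths-enter : HasDisjointPaths E 0 t l → ∀ {i} → i < l → Walk E (1 + i * N) t
    disjointPaths-enter (ps , |ps|≡l , !ps) i<l
      with w , _ , refl ← ∈-map⁻ tree (Unique-<-full⇒∈ l (trees-Unique ps !ps) (trees-< ps)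
                                         (trans (length-map tree ps) |ps|≡l) i<l)
      = proj₂ (proj₂ (proj₂ (departure w)))

  module Cut (i : ℕ) (i<l : i < l) (BS : List Bool) (|BS|≡k : length BS ≡ k)
             (y : ℕ) (Y₀≤y : Y₀ ≤ y) (y<n : y < n) where

    inTree : ℕ × ℕ → ℕ × ℕ
    inTree (a , c) = vertex i a , vertex i c

    F : List (ℕ × ℕ)
    F = map inTree (exits 0 BS)

    x : ℕ
    x = descend 0 BS

    BS-LeafPath : LeafPath k 0 BS
    BS-LeafPath = LeafPath-root |BS|≡k

    x-LeafPath : LeafPath k x []
    x-LeafPath = descend-LeafPath BS BS-LeafPath

    onBS-< : ∀ {a} → OnPath 0 BS a → a < N
    onBS-< = onPath-< BS-LeafPath

    F-length : length F ≤ k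
    F-length = ≤-reflexive (trans (length-map inTree (exits 0 BS)) (trans (exits-length 0 BS) |BS|≡k))

    F⊆G : All (λ e → G (proj₁ e) (proj₂ e)) F
    F⊆G = Allₚ.map⁺ (All.map (treeEdge i<l) (exits-TreeEdge BS BS-LeafPath))

    source∉F : ∀ {v} → (0 , v) ∉ F
    source∉F e∈F with _ , _ , () ← ∈-map⁻ inTree e∈F

    toY∉F : ∀ {u} → (u , y) ∉ F
    toY∉F e∈F with _ , ac∈exits , refl ← ∈-map⁻ inTree e∈F =
      contradiction (vertex-< {i} i<l (proj₁ (proj₂ (exits-offPath BS-LeafPath ac∈exits)))) (≤⇒≯ Y₀≤y)

    onPath∉F : ∀ {i′ a c} → c < N → OnPath 0 BS c → (vertex i′ a , vertex i′ c) ∉ F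
    onPath∉F {i′} c<N c∈BS e∈F
      with _ , ac∈exits , eq ← ∈-map⁻ inTree e∈F
      with _ , c′<N , c′∉BS ← exits-offPath BS-LeafPath ac∈exits
      with _ , refl ← vertex-injective {i′} {i} c<N c′<N (cong proj₂ eq)
      = c′∉BS c∈BS

    descendWalk : ∀ {i′ j bs} → i′ < l → LeafPath k j bs → (∀ {c} → OnPath j bs c → OnPath 0 BS c) →
                  Walk (G ∖ F) (vertex i′ j) (vertex i′ (descend j bs))
    descendWalk {bs = []}         _    _  _   = []
    descendWalk {i′} {j} {b ∷ bs} i′<l lp ⊆BS =
      (treeEdge i′<l (toChild b (LeafPath-internal lp)) ,
       onPath∉F {i′} {j} (LeafPath-< (LeafPath-child lp b)) (⊆BS (next start)))
      ∷ descendWalk i′<l (LeafPath-child lp b) (⊆BS ∘ next)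

    toY : ∀ {i′} → i′ < l → Walk (G ∖ F) (vertex i′ x) y
    toY {i′} i′<l =
      (leaf→Y i′ x y i′<l (LeafPath-leaf x-LeafPath) (LeafPath-< x-LeafPath) Y₀≤y y<n , toY∉F) ∷ []

    treeWalk : ∀ {i′} → i′ < l → Walk (G ∖ F) 0 y
    treeWalk {i′} i′<l =
      (subst (G 0) (sym (+-identityʳ (1 + i′ * N))) (s→root i′ i′<l) , source∉F)
      ∷ (descendWalk i′<l BS-LeafPath id ++ʷ toY i′<l)

    treeWalk-Ascending : ∀ {i′} (i′<l : i′ < l) →
                         Ascending (2 * vertex i′ 0) (2 * vertex (suc i′) 0) (walkEdges (treeWalk i′<l))
    treeWalk-Ascending {i′} i′<l =
      ≤-refl ∷ Ascending-++ʷ (G-upward ∘ proj₁) (descendWalk i′<l BS-LeafPath id) (toY i′<l)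
                 (≤-refl ∷ [] last≤)
      where
      last≤ : suc (suc (2 * vertex i′ x)) ≤ 2 * vertex (suc i′) 0
      last≤ = subst (_≤ 2 * vertex (suc i′) 0) (*-suc 2 (vertex i′ x))
                (*-monoʳ-≤ 2 (vertex-<-next {i′} (LeafPath-< x-LeafPath)))

    treeWalks : ∀ i′ c → i′ + c ≡ l → List (Walk (G ∖ F) 0 y)
    treeWalks i′ zero    _      = []
    treeWalks i′ (suc c) i′+c≡l =
      treeWalk (subst (i′ <_) i′+c≡l (m<m+n i′ z<s))
      ∷ treeWalks (suc i′) c (trans (sym (+-suc i′ c)) i′+c≡l)

    treeWalks-length : ∀ i′ c (i′+c≡l : i′ + c ≡ l) → length (treeWalks i′ c i′+c≡l) ≡ c
    treeWalks-length i′ zero    _ = refl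
    treeWalks-length i′ (suc c) _ = cong suc (treeWalks-length (suc i′) c _)

    treeWalks-Ascending : ∀ i′ c (i′+c≡l : i′ + c ≡ l) →
      Ascending (2 * vertex i′ 0) (2 * vertex (i′ + c) 0) (concatMap walkEdges (treeWalks i′ c i′+c≡l))
    treeWalks-Ascending i′ zero    _      =
      [] (≤-reflexive (cong (λ m → 2 * vertex m 0) (sym (+-identityʳ i′))))
    treeWalks-Ascending i′ (suc c) i′+c≡l = Ascending-++ (treeWalk-Ascending _)
      (subst (λ m → Ascending (2 * vertex (suc i′) 0) (2 * vertex m 0) (concatMap walkEdges rest))
             (sym (+-suc i′ c)) (treeWalks-Ascending (suc i′) c _))
      where
      rest : List (Walk (G ∖ F) 0 y)
      rest = treeWalks (suc i′) c (trans (sym (+-suc i′ c)) i′+c≡l)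

    y≢s : y ≢ 0
    y≢s refl = contradiction Y₀≤y λ ()

    maxFlow-G∖F : MaxFlow (G ∖ F) 0 y l
    maxFlow-G∖F =
      (treeWalks 0 l refl , treeWalks-length 0 l refl , Ascending⇒Unique (treeWalks-Ascending 0 l refl)) ,
      λ _ → Departures.disjointPaths-≤ proj₁ y≢s

    module _ (H : ℕ → ℕ → Bool) (H-FTBFP : IsFTBFP l k n G 0 H) where

      H∖F⊆G : ∀ {u v} → (asRel H ∖ F) u v → G u v
      H∖F⊆G {u} {v} (h , _) = proj₁ H-FTBFP u v h

      reach : ∀ {u a} → Walk (asRel H ∖ F) u y → u ≡ vertex i a → OnPath 0 BS a → H (vertex i x) y ≡ true
      reach [] y≡ a∈BS =
        contradiction (vertex-< {i} i<l (onBS-< a∈BS)) (subst (λ v → ¬ v < Y₀) y≡ (≤⇒≯ Y₀≤y))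
      reach (e@(h , ∉F) ∷ w) u≡ a∈BS with H∖F⊆G e
      ... | s→root _ _ = contradiction u≡ 0≢1+n
      ... | left i′ _ _ internal
        with refl , refl ← vertex-injective {i′} {i} (internal-< {k} internal) (onBS-< a∈BS) u≡ =
        reach w refl (onPath-child BS-LeafPath a∈BS internal false (∉F ∘ ∈-map⁺ inTree))
      ... | right i′ _ _ internal
        with refl , refl ← vertex-injective {i′} {i} (internal-< {k} internal) (onBS-< a∈BS) u≡ =
        reach w refl (onPath-child BS-LeafPath a∈BS internal true (∉F ∘ ∈-map⁺ inTree))
      ... | leaf→Y i′ _ _ _ leaf j<N Y₀≤v _
        with refl , refl ← vertex-injective {i′} {i} j<N (onBS-< a∈BS) u≡
        with refl ← Y-sink H∖F⊆G w Y₀≤v =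
        subst (λ a → H (vertex i a) y ≡ true) (onPath-leaf BS-LeafPath a∈BS leaf) h

      x→y∈H : H (vertex i x) y ≡ true
      x→y∈H = reach (Departures.disjointPaths-enter H∖F⊆G y≢s flow-H∖F i<l)
                    (sym (+-identityʳ (1 + i * N))) start
        where
        flow-H∖F : HasDisjointPaths (asRel H ∖ F) 0 y l
        flow-H∖F = proj₁ (proj₁ (proj₂ H-FTBFP F F-length F⊆G y y<n l maxFlow-G∖F) ≤-refl)

  module _ (H : ℕ → ℕ → Bool) (H-FTBFP : IsFTBFP l k n G 0 H) where

    leafEdges∈H : ∀ {i j y} → i < l → 2 ^ k ≤ j + 1 → j < N → Y₀ ≤ y → y < n → H (vertex i j) y ≡ true
    leafEdges∈H {i} {j} {y} i<l leaf j<N Y₀≤y y<n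
      with BS , |BS|≡k , refl ← descend-onto k (leaf⇒Depth leaf j<N)
      = Cut.x→y∈H i i<l BS |BS|≡k y Y₀≤y y<n H H-FTBFP

    edge? : ℕ → ℕ → ℕ
    edge? u v = if H u v then 1 else 0

    outDegree : ℕ → ℕ
    outDegree u = sum (map (edge? u) (upTo n))

    outDegree-leaf : ∀ {i j} → i < l → 2 ^ k ≤ j + 1 → j < N → Y₀ ≤ n → n ∸ Y₀ ≤ outDegree (vertex i j)
    outDegree-leaf {i} {j} i<l leaf j<N Y₀≤n = begin
      n ∸ Y₀                                 ≡⟨ *-identityʳ (n ∸ Y₀) ⟨
      (n ∸ Y₀) * 1                           ≤⟨ sum-applyUpTo-≥-interval (edge? (vertex i j))
                                                  (≤-reflexive (m+[n∸m]≡n Y₀≤n)) edge∈H ⟩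
      sum (applyUpTo (edge? (vertex i j)) n) ≡⟨ cong sum (map-upTo (edge? (vertex i j)) n) ⟨
      outDegree (vertex i j)                 ∎
      where
      open ≤-Reasoning
      edge∈H : ∀ {v} → v < n ∸ Y₀ → 1 ≤ edge? (vertex i j) (Y₀ + v)
      edge∈H {v} v<|Y| rewrite leafEdges∈H i<l leaf j<N (m≤m+n Y₀ v)
                                 (subst (Y₀ + v <_) (m+[n∸m]≡n Y₀≤n) (+-monoʳ-< Y₀ v<|Y|)) = ≤-refl

    edgeCount-≥ : Y₀ ≤ n → l * (2 ^ k * (n ∸ Y₀)) ≤ edgeCount n H
    edgeCount-≥ Y₀≤n = begin
      l * (2 ^ k * (n ∸ Y₀))                     ≤⟨ sum-applyUpTo-≥-blocks (outDegree ∘ suc) l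
                                                      (≤-reflexive (sym (treeSize-split k))) leaf-rows ⟩
      sum (applyUpTo (outDegree ∘ suc) (l * N))  ≤⟨ m≤n+m _ (outDegree 0) ⟩
      sum (applyUpTo outDegree Y₀)               ≤⟨ sum-applyUpTo-mono outDegree Y₀≤n ⟩
      sum (applyUpTo outDegree n)                ≡⟨ cong sum (map-upTo outDegree n) ⟨
      edgeCount n H                              ∎
      where
      open ≤-Reasoning
      leaf-rows : ∀ {i u} → i < l → u < 2 ^ k → n ∸ Y₀ ≤ outDegree (vertex i ((2 ^ k ∸ 1) + u))
      leaf-rows {i} {u} i<l u<2ᵏ = outDegree-leaf i<l leaf j<N Y₀≤n
        where
        leaf : 2 ^ k ≤ (2 ^ k ∸ 1) + u + 1
        leaf = subst (_≤ (2 ^ k ∸ 1) + u + 1) (m∸n+n≡m (m^n>0 2 k)) (+-monoˡ-≤ 1 (m≤m+n (2 ^ k ∸ 1) u))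
        j<N : (2 ^ k ∸ 1) + u < N
        j<N = subst ((2 ^ k ∸ 1) + u <_) (sym (treeSize-split k)) (+-monoʳ-< (2 ^ k ∸ 1) u<2ᵏ)

  Y₀≤2l2ᵏ : 1 ≤ l → Y₀ ≤ 2 * (l * 2 ^ k)
  Y₀≤2l2ᵏ 1≤l = begin
    1 + l * N          ≤⟨ +-monoˡ-≤ (l * N) 1≤l ⟩
    l + l * N          ≡⟨ *-suc l N ⟨
    l * suc N          ≡⟨ cong (l *_) (suc-treeSize k) ⟩
    l * (2 * 2 ^ k)    ≡⟨ *-assoc l 2 (2 ^ k) ⟨
    l * 2 * 2 ^ k      ≡⟨ cong (_* 2 ^ k) (*-comm l 2) ⟩
    2 * l * 2 ^ k      ≡⟨ *-assoc 2 l (2 ^ k) ⟩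
    2 * (l * 2 ^ k)    ∎
    where open ≤-Reasoning

  module _ (1≤l : 1 ≤ l) (3l2ᵏ≤n : 3 * l * 2 ^ k ≤ n) where

    private
      3[l2ᵏ]≤n : 3 * (l * 2 ^ k) ≤ n
      3[l2ᵏ]≤n = subst (_≤ n) (*-assoc 3 l (2 ^ k)) 3l2ᵏ≤n

    Y₀≤n : Y₀ ≤ n
    Y₀≤n = begin
      Y₀               ≤⟨ Y₀≤2l2ᵏ 1≤l ⟩
      2 * (l * 2 ^ k)  ≤⟨ *-monoˡ-≤ (l * 2 ^ k) {2} {3} (s≤s (s≤s z≤n)) ⟩
      3 * (l * 2 ^ k)  ≤⟨ 3[l2ᵏ]≤n ⟩
      n                ∎
      where open ≤-Reasoning

    n≤3|Y| : n ≤ 3 * (n ∸ Y₀)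
    n≤3|Y| = n≤3[n∸a] (l * 2 ^ k) (Y₀≤2l2ᵏ 1≤l) 3[l2ᵏ]≤n

lemma12 : ∃[ C ] (∀ (l k n : ℕ) → 1 ≤ l → 1 ≤ k → 3 * l * 2 ^ k ≤ n →
              ∀ (H : ℕ → ℕ → Bool) → IsFTBFP l k n (GEdge l k n) 0 H →
              2 ^ k * l * n ≤ C * edgeCount n H)
lemma12 = 3 , λ l k n 1≤l _ 3l2ᵏ≤n H H-FTBFP →
  let open Construction l k n
      open ≤-Reasoning
      |Y| : ℕ
      |Y| = n ∸ Y₀
  in begin
    2 ^ k * l * n            ≤⟨ *-monoʳ-≤ (2 ^ k * l) (n≤3|Y| 1≤l 3l2ᵏ≤n) ⟩
    2 ^ k * l * (3 * |Y|)    ≡⟨ reorder (2 ^ k) l |Y| ⟩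
    3 * (l * (2 ^ k * |Y|))  ≤⟨ *-monoʳ-≤ 3 (edgeCount-≥ H H-FTBFP (Y₀≤n 1≤l 3l2ᵏ≤n)) ⟩
    3 * edgeCount n H        ∎
  where
  reorder : ∀ a b c → a * b * (3 * c) ≡ 3 * (b * (a * c))
  reorder = solve-∀
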